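{- Let $s\geq 4$ be an even integer and let $\overline{D}_{s}(n)$ denote the number of $s$-duplicate overpartitions of $n$. Then \[ \sum_{n\geq 0} \overline{D}_{s}(n) q^{n} = \frac{(-2q;q)_{\infty}(-q^{s/2};q^{s/2})_{\infty}}{(-2q^{s/2};q^{s/2})_{\infty} (q^{s/2};q^{s/2})_{\infty}}=\frac{(-2q;q)_{\infty}(q^{s};q^{s})_{\infty}}{(-2q^{s/2};q^{s/2})_{\infty} (q^{s/2};q^{s/2})^{2}_{\infty}}. \]
   Context: An overpartition of $n$ is a nonincreasing sequence of positive integers summing to $n$ in which the first occurrence of each distinct part value may optionally be overlined. An $s$-duplicate overpartition is an overpartition in which every part value occurring with multiplicity greater than one is divisible by $s/2$. Notation: $(a;q)_{\infty}=\prod_{i\geq 0}(1-aq^{i})$. -}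

module Defs where

open import Data.Nat as ℕ using (ℕ; zero; suc; _≤_; _<_; _∸_; _≟_)
open import Data.Nat.Divisibility using (_∣_)
open import Data.Nat.DivMod using (_/_)
open import Data.Integer as ℤ using (ℤ; +_; -_)
open import Data.Bool using (Bool; true; false; if_then_else_)
open import Data.Product using (Σ; _×_; proj₁; proj₂; _,_)
open import Data.Nat.ListAction using (sum)
open import Data.List using (List; []; _∷_; map; filter; length; upTo; foldr; zipWith; applyUpTo)
open import Data.List.Relation.Unary.All using (All)
open import Data.List.Relation.Unary.Linked using (Linked)
open import Data.List.Relation.Unary.Unique.Propositional using (Unique)
open import Data.List.Membership.Propositional using (_∈_)
open import Relation.Binary.PropositionalEquality using (_≡_)
open import Relation.Nullary.Decidable using (⌊_⌋)
open import Function.Bundles using (_⇔_)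

-- A part: its value and whether it is overlined (true = overlined).
Part : Set
Part = ℕ × Bool

-- Relation between consecutive parts (a , oa) (b , ob):
-- nonincreasing, and b may be overlined only if it is the first
-- occurrence of its value (i.e. the previous part has a different value).
ConsecOK : Part → Part → Set
ConsecOK (a , oa) (b , ob) = (b ≤ a) × (a ≡ b → ob ≡ false)

IsOverpartition : ℕ → List Part → Set
IsOverpartition n p =
  All (λ x → 1 ≤ proj₁ x) p × Linked ConsecOK p × sum (map proj₁ p) ≡ n

mult : ℕ → List Part → ℕ
mult k p = length (filter (λ x → proj₁ x ≟ k) p)

IsSDupOverpartition : ℕ → ℕ → List Part → Set
IsSDupOverpartition s n p =
  IsOverpartition n p × (∀ k → 1 < mult k p → (s / 2) ∣ k)

-- "c is the number of elements satisfying P": there is a duplicate-free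
-- list enumerating exactly the elements satisfying P, of length c.
-- (c is an integer; the statement says in particular that it is ≥ 0.)
HasCount : {A : Set} → (A → Set) → ℤ → Set
HasCount {A} P c =
  Σ (List A) λ L → Unique L × (∀ x → (x ∈ L) ⇔ P x) × + (length L) ≡ c

-- Formal power series in q with integer coefficients, as coefficient
-- sequences: f n = coefficient of q^n.

Series : Set
Series = ℕ → ℤ

one : Series
one zero    = + 1
one (suc _) = + 0

_⊛_ : Series → Series → Series
(f ⊛ g) n = sum' (map (λ i → f i ℤ.* g (n ∸ i)) (upTo (suc n)))
  where
  sum' : List ℤ → ℤ
  sum' = foldr ℤ._+_ (+ 0)

infixl 7 _⊛_

oneMinus : ℤ → ℕ → Series
oneMinus c e j =
  (if ⌊ j ≟ 0 ⌋ then + 1 else + 0) ℤ.+ (if ⌊ j ≟ e ⌋ then - c else + 0)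

prodUpTo : (ℕ → Series) → ℕ → Series
prodUpTo F zero    = one
prodUpTo F (suc N) = prodUpTo F N ⊛ F N

-- q-Pochhammer symbol (c q^k ; q^m)_∞ = ∏_{i≥0} (1 - c q^(k + m i)),
-- for k ≥ 1, m ≥ 1.  Its coefficient of q^n only involves the factors with
-- k + m i ≤ n, hence i ≤ n; so it equals the coefficient of q^n in the
-- finite product over i < n + 1.
poch : ℤ → ℕ → ℕ → Series
poch c k m n = prodUpTo (λ i → oneMinus c (k ℕ.+ m ℕ.* i)) (suc n) n

-- Multiplicative inverse of a series with constant term 1:
-- g 0 = 1,  g n = - Σ_{j=1}^{n} f j * g (n - j).
-- invRev f n = [ g n , g (n-1) , … , g 0 ].
invRev : Series → ℕ → List ℤ
invRev f zero    = + 1 ∷ []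
invRev f (suc n) =
  (- foldr ℤ._+_ (+ 0) (zipWith ℤ._*_ (applyUpTo (λ j → f (suc j)) (suc n)) gs)) ∷ gs
  where
  gs = invRev f n

inv : Series → Series
inv f n with invRev f n
... | []    = + 0
... | g ∷ _ = g

-- With t = s / 2, a t-duplicate overpartition is described, part size by part
-- size, by its run of parts equal to a: nothing, or a single part a (overlined
-- or not), or, only when t ∣ a, any number of parts a with the first one
-- possibly overlined. So its generating function is ∏ₐ Fₐ with Fₐ = 1 + 2qᵃ
-- for t ∤ a and Fₐ (1 − qᵃ) = 1 + qᵃ for t ∣ a. Multiplying by the factors
-- (1 + 2qᵃ)(1 − qᵃ) at the multiples a of t turns ∏ₐ Fₐ into
-- (−2q;q)∞ (−qᵗ;qᵗ)∞, and (1 + qᵃ)(1 − qᵃ) = 1 − q²ᵃ gives the second form.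
-- Everything is finite: overpartitions with parts ≤ m are counted by ∏_{a ≤ m} Fₐ,
-- and the coefficient of qⁿ of an infinite product is that of any truncation
-- containing all factors 1 − c qᵉ with e ≤ n.
{-# OPTIONS --safe #-}
module Submission where

open import Defs
open import Algebra.Bundles using (CommutativeMonoid)
import Algebra.Properties.CommutativeSemigroup as CommutativeSemigroupProperties
open import Data.Bool using (Bool; true; false; if_then_else_)
open import Data.Empty using (⊥-elim)
open import Data.Integer as ℤ using (ℤ; +_; -_)
import Data.Integer.Properties as ℤP
open import Data.Integer.Tactic.RingSolver using (solve-∀)
open import Data.List
  using (List; []; _∷_; _++_; map; foldr; filter; length; replicate; concat; applyUpTo; zipWith; cartesianProductWith)
open import Data.List.Membership.Propositional using (_∈_)
open import Data.List.Membership.Propositional.Properties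
  using ( ∈-map⁻; ∈-++⁻; ∈-concat⁻′; ∈-concat⁺′; ∈-applyUpTo⁻; ∈-applyUpTo⁺
        ; ∈-cartesianProductWith⁻; ∈-cartesianProductWith⁺)
import Data.List.Properties as List
open import Data.List.Relation.Binary.Disjoint.Propositional using (Disjoint)
open import Data.List.Relation.Unary.All as All using (All; []; _∷_)
import Data.List.Relation.Unary.All.Properties as All
open import Data.List.Relation.Unary.AllPairs using ([]; _∷_)
import Data.List.Relation.Unary.AllPairs.Properties as AllPairs
open import Data.List.Relation.Unary.Any using (here; there)
open import Data.List.Relation.Unary.Linked as Linked using (Linked; []; [-]; _∷_)
open import Data.List.Relation.Unary.Unique.Propositional using (Unique)
import Data.List.Relation.Unary.Unique.Propositional.Properties as Unique
open import Data.Nat as ℕ using (ℕ; zero; suc; _≤_; _<_; _∸_; _≟_; z≤n; s≤s; _/_; NonZero)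
open import Data.Nat.Divisibility using (_∣_; _∣?_; divides; ∣m+n∣m⇒∣n; n∣m*n; ∣⇒≤)
open import Data.Nat.DivMod using (m*n/n≡m)
open import Data.Nat.ListAction using (sum)
open import Data.Nat.ListAction.Properties using (sum-++)
import Data.Nat.Properties as ℕP
import Data.Nat.Tactic.RingSolver as NatSolver
open import Data.Product using (∃; ∃₂; _×_; _,_; proj₁; proj₂)
open import Data.Sum using (_⊎_; inj₁; inj₂)
open import Function using (id; _∘_)
open import Function.Bundles using (mk⇔)
open import Relation.Binary.Bundles using (Setoid)
open import Relation.Binary.PropositionalEquality
import Relation.Binary.Reasoning.Setoid as SetoidReasoning
open import Relation.Nullary using (¬_; Dec; yes; no)
open import Relation.Nullary.Decidable using (⌊_⌋; dec-true; dec-false; isYes≗does; _×-dec_; _⊎-dec_)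

length-cartesianProductWith : ∀ {A B C : Set} (f : A → B → C) xs ys →
  length (cartesianProductWith f xs ys) ≡ length xs ℕ.* length ys
length-cartesianProductWith f []       ys = refl
length-cartesianProductWith f (x ∷ xs) ys = trans (List.length-++ (map (f x) ys))
  (cong₂ ℕ._+_ (List.length-map (f x) ys) (length-cartesianProductWith f xs ys))

module PowerSeries where
  open import Data.Integer using (_+_; _*_)
  open CommutativeSemigroupProperties ℤP.+-commutativeSemigroup using () renaming (interchange to +-interchange)

  infix 4 _≈_ _≈[_]_

  _≈_ : Series → Series → Set
  f ≈ g = ∀ n → f n ≡ g n

  _≈[_]_ : Series → ℕ → Series → Set
  f ≈[ N ] g = ∀ n → n ≤ N → f n ≡ g n

  ≈-refl : ∀ {f} → f ≈ f
  ≈-refl _ = refl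

  ≈-sym : ∀ {f g} → f ≈ g → g ≈ f
  ≈-sym f≈g n = sym (f≈g n)

  ≈-trans : ∀ {f g h} → f ≈ g → g ≈ h → f ≈ h
  ≈-trans f≈g g≈h n = trans (f≈g n) (g≈h n)

  sumUpTo : (ℕ → ℤ) → ℕ → ℤ
  sumUpTo g n = foldr _+_ (+ 0) (applyUpTo g n)

  sumUpTo-cong : ∀ n {g h} → (∀ i → i < n → g i ≡ h i) → sumUpTo g n ≡ sumUpTo h n
  sumUpTo-cong zero    _   = refl
  sumUpTo-cong (suc n) g≡h =
    cong₂ _+_ (g≡h 0 (s≤s z≤n)) (sumUpTo-cong n (λ i i<n → g≡h (suc i) (s≤s i<n)))

  sumUpTo-zero : ∀ n → sumUpTo (λ _ → + 0) n ≡ + 0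
  sumUpTo-zero zero    = refl
  sumUpTo-zero (suc n) = trans (ℤP.+-identityˡ _) (sumUpTo-zero n)

  sumUpTo-distrib-+ : ∀ n g h → sumUpTo (λ i → g i + h i) n ≡ sumUpTo g n + sumUpTo h n
  sumUpTo-distrib-+ zero    g h = refl
  sumUpTo-distrib-+ (suc n) g h =
    trans (cong (_+_ (g 0 + h 0)) (sumUpTo-distrib-+ n (g ∘ suc) (h ∘ suc)))
          (+-interchange (g 0) (h 0) _ _)

  sumUpTo-*ˡ : ∀ n c g → sumUpTo (λ i → c * g i) n ≡ c * sumUpTo g n
  sumUpTo-*ˡ zero    c g = sym (ℤP.*-zeroʳ c)
  sumUpTo-*ˡ (suc n) c g =
    trans (cong (_+_ (c * g 0)) (sumUpTo-*ˡ n c (g ∘ suc))) (sym (ℤP.*-distribˡ-+ c (g 0) _))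

  sumUpTo-last : ∀ n g → sumUpTo g (suc n) ≡ sumUpTo g n + g n
  sumUpTo-last zero    g = ℤP.+-comm (g 0) (+ 0)
  sumUpTo-last (suc n) g =
    trans (cong (_+_ (g 0)) (sumUpTo-last n (g ∘ suc))) (sym (ℤP.+-assoc (g 0) _ _))

  sumUpTo-reverse : ∀ n g → sumUpTo g (suc n) ≡ sumUpTo (λ i → g (n ∸ i)) (suc n)
  sumUpTo-reverse zero    g = refl
  sumUpTo-reverse (suc n) g = begin
    g 0 + sumUpTo (g ∘ suc) (suc n)
      ≡⟨ cong (_+_ (g 0)) (sumUpTo-reverse n (g ∘ suc)) ⟩
    g 0 + sumUpTo (λ i → g (suc (n ∸ i))) (suc n)
      ≡⟨ ℤP.+-comm (g 0) _ ⟩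
    sumUpTo (λ i → g (suc (n ∸ i))) (suc n) + g 0
      ≡⟨ cong₂ _+_ (sumUpTo-cong (suc n) λ i i≤n → cong g (sym (ℕP.+-∸-assoc 1 (ℕP.≤-pred i≤n))))
                   (cong g (sym (ℕP.n∸n≡0 n))) ⟩
    sumUpTo (λ i → g (suc n ∸ i)) (suc n) + g (suc n ∸ suc n)
      ≡⟨ sumUpTo-last (suc n) (λ i → g (suc n ∸ i)) ⟨
    sumUpTo (λ i → g (suc n ∸ i)) (suc (suc n)) ∎
    where open ≡-Reasoning

  length-concat-applyUpTo : ∀ {A : Set} (h : ℕ → List A) n →
    + length (concat (applyUpTo h n)) ≡ sumUpTo (λ i → + length (h i)) n
  length-concat-applyUpTo h zero    = refl
  length-concat-applyUpTo h (suc n) = trans (cong +_ (List.length-++ (h 0)))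
    (trans (ℤP.pos-+ (length (h 0)) _) (cong (_+_ (+ length (h 0))) (length-concat-applyUpTo (h ∘ suc) n)))

  ⊛-as-sum : ∀ f g n → (f ⊛ g) n ≡ sumUpTo (λ i → f i * g (n ∸ i)) (suc n)
  ⊛-as-sum f g n = cong (foldr _+_ (+ 0)) (List.map-upTo (λ i → f i * g (n ∸ i)) (suc n))

  ⊛-at-0 : ∀ f g → (f ⊛ g) 0 ≡ f 0 * g 0
  ⊛-at-0 f g = ℤP.+-identityʳ _

  ⊛-at-suc : ∀ f g n → (f ⊛ g) (suc n) ≡ f 0 * g (suc n) + ((f ∘ suc) ⊛ g) n
  ⊛-at-suc f g n =
    trans (⊛-as-sum f g (suc n)) (cong (_+_ (f 0 * g (suc n))) (sym (⊛-as-sum (f ∘ suc) g n)))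

  ⊛-cong[] : ∀ {f f′ g g′} N → f ≈[ N ] f′ → g ≈[ N ] g′ → f ⊛ g ≈[ N ] f′ ⊛ g′
  ⊛-cong[] {f} {f′} {g} {g′} N f≈f′ g≈g′ n n≤N = begin
    (f ⊛ g) n
      ≡⟨ ⊛-as-sum f g n ⟩
    sumUpTo (λ i → f i * g (n ∸ i)) (suc n)
      ≡⟨ sumUpTo-cong (suc n) (λ i i≤n → cong₂ _*_ (f≈f′ i (ℕP.≤-trans (ℕP.≤-pred i≤n) n≤N))
                                                   (g≈g′ (n ∸ i) (ℕP.≤-trans (ℕP.m∸n≤m n i) n≤N))) ⟩
    sumUpTo (λ i → f′ i * g′ (n ∸ i)) (suc n)
      ≡⟨ ⊛-as-sum f′ g′ n ⟨
    (f′ ⊛ g′) n ∎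
    where open ≡-Reasoning

  ⊛-cong : ∀ {f f′ g g′} → f ≈ f′ → g ≈ g′ → f ⊛ g ≈ f′ ⊛ g′
  ⊛-cong f≈f′ g≈g′ n = ⊛-cong[] n (λ i _ → f≈f′ i) (λ i _ → g≈g′ i) n ℕP.≤-refl

  ⊛-distribʳ-+ : ∀ f g h n → ((λ i → f i + g i) ⊛ h) n ≡ (f ⊛ h) n + (g ⊛ h) n
  ⊛-distribʳ-+ f g h n = begin
    ((λ i → f i + g i) ⊛ h) n
      ≡⟨ ⊛-as-sum (λ i → f i + g i) h n ⟩
    sumUpTo (λ i → (f i + g i) * h (n ∸ i)) (suc n)
      ≡⟨ sumUpTo-cong (suc n) (λ i _ → ℤP.*-distribʳ-+ (h (n ∸ i)) (f i) (g i)) ⟩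
    sumUpTo (λ i → f i * h (n ∸ i) + g i * h (n ∸ i)) (suc n)
      ≡⟨ sumUpTo-distrib-+ (suc n) (λ i → f i * h (n ∸ i)) (λ i → g i * h (n ∸ i)) ⟩
    sumUpTo (λ i → f i * h (n ∸ i)) (suc n) + sumUpTo (λ i → g i * h (n ∸ i)) (suc n)
      ≡⟨ cong₂ _+_ (⊛-as-sum f h n) (⊛-as-sum g h n) ⟨
    (f ⊛ h) n + (g ⊛ h) n ∎
    where open ≡-Reasoning

  ⊛-*ˡ : ∀ c f h n → ((λ i → c * f i) ⊛ h) n ≡ c * (f ⊛ h) n
  ⊛-*ˡ c f h n = begin
    ((λ i → c * f i) ⊛ h) n
      ≡⟨ ⊛-as-sum (λ i → c * f i) h n ⟩
    sumUpTo (λ i → c * f i * h (n ∸ i)) (suc n)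
      ≡⟨ sumUpTo-cong (suc n) (λ i _ → ℤP.*-assoc c (f i) (h (n ∸ i))) ⟩
    sumUpTo (λ i → c * (f i * h (n ∸ i))) (suc n)
      ≡⟨ sumUpTo-*ˡ (suc n) c (λ i → f i * h (n ∸ i)) ⟩
    c * sumUpTo (λ i → f i * h (n ∸ i)) (suc n)
      ≡⟨ cong (c *_) (⊛-as-sum f h n) ⟨
    c * (f ⊛ h) n ∎
    where open ≡-Reasoning

  ⊛-zeroˡ : ∀ h n → ((λ _ → + 0) ⊛ h) n ≡ + 0
  ⊛-zeroˡ h n = trans (⊛-as-sum (λ _ → + 0) h n)
    (trans (sumUpTo-cong (suc n) (λ i _ → ℤP.*-zeroˡ (h (n ∸ i)))) (sumUpTo-zero (suc n)))

  ⊛-identityˡ : ∀ f → one ⊛ f ≈ f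
  ⊛-identityˡ f zero    = trans (⊛-at-0 one f) (ℤP.*-identityˡ (f 0))
  ⊛-identityˡ f (suc n) = trans (⊛-at-suc one f n)
    (trans (cong₂ _+_ (ℤP.*-identityˡ (f (suc n))) (⊛-zeroˡ f n)) (ℤP.+-identityʳ _))

  ⊛-comm : ∀ f g → f ⊛ g ≈ g ⊛ f
  ⊛-comm f g n = begin
    (f ⊛ g) n
      ≡⟨ ⊛-as-sum f g n ⟩
    sumUpTo (λ i → f i * g (n ∸ i)) (suc n)
      ≡⟨ sumUpTo-reverse n (λ i → f i * g (n ∸ i)) ⟩
    sumUpTo (λ i → f (n ∸ i) * g (n ∸ (n ∸ i))) (suc n)
      ≡⟨ sumUpTo-cong (suc n) (λ i i≤n →
           trans (cong (λ j → f (n ∸ i) * g j) (ℕP.m∸[m∸n]≡n (ℕP.≤-pred i≤n))) (ℤP.*-comm (f (n ∸ i)) (g i))) ⟩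
    sumUpTo (λ i → g i * f (n ∸ i)) (suc n)
      ≡⟨ ⊛-as-sum g f n ⟨
    (g ⊛ f) n ∎
    where open ≡-Reasoning

  ⊛-identityʳ : ∀ f → f ⊛ one ≈ f
  ⊛-identityʳ f = ≈-trans (⊛-comm f one) (⊛-identityˡ f)

  ⊛-assoc : ∀ f g h → (f ⊛ g) ⊛ h ≈ f ⊛ (g ⊛ h)
  ⊛-assoc f g h zero = begin
    ((f ⊛ g) ⊛ h) 0     ≡⟨ ⊛-at-0 (f ⊛ g) h ⟩
    (f ⊛ g) 0 * h 0     ≡⟨ cong (_* h 0) (⊛-at-0 f g) ⟩
    f 0 * g 0 * h 0     ≡⟨ ℤP.*-assoc (f 0) (g 0) (h 0) ⟩
    f 0 * (g 0 * h 0)   ≡⟨ cong (f 0 *_) (⊛-at-0 g h) ⟨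
    f 0 * (g ⊛ h) 0     ≡⟨ ⊛-at-0 f (g ⊛ h) ⟨
    (f ⊛ (g ⊛ h)) 0     ∎
    where open ≡-Reasoning
  ⊛-assoc f g h (suc n) = begin
    ((f ⊛ g) ⊛ h) (suc n)
      ≡⟨ ⊛-at-suc (f ⊛ g) h n ⟩
    (f ⊛ g) 0 * h (suc n) + (((f ⊛ g) ∘ suc) ⊛ h) n
      ≡⟨ cong₂ (λ a b → a * h (suc n) + b) (⊛-at-0 f g) (⊛-cong {g = h} (⊛-at-suc f g) ≈-refl n) ⟩
    f 0 * g 0 * h (suc n) + ((λ i → f 0 * g (suc i) + ((f ∘ suc) ⊛ g) i) ⊛ h) n
      ≡⟨ cong (_+_ (f 0 * g 0 * h (suc n))) (⊛-distribʳ-+ (λ i → f 0 * g (suc i)) ((f ∘ suc) ⊛ g) h n) ⟩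
    f 0 * g 0 * h (suc n) + (((λ i → f 0 * g (suc i)) ⊛ h) n + (((f ∘ suc) ⊛ g) ⊛ h) n)
      ≡⟨ cong₂ (λ a b → f 0 * g 0 * h (suc n) + (a + b)) (⊛-*ˡ (f 0) (g ∘ suc) h n) (⊛-assoc (f ∘ suc) g h n) ⟩
    f 0 * g 0 * h (suc n) + (f 0 * ((g ∘ suc) ⊛ h) n + ((f ∘ suc) ⊛ (g ⊛ h)) n)
      ≡⟨ regroup (f 0) (g 0) (h (suc n)) _ _ ⟩
    f 0 * (g 0 * h (suc n) + ((g ∘ suc) ⊛ h) n) + ((f ∘ suc) ⊛ (g ⊛ h)) n
      ≡⟨ cong (λ x → f 0 * x + ((f ∘ suc) ⊛ (g ⊛ h)) n) (⊛-at-suc g h n) ⟨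
    f 0 * (g ⊛ h) (suc n) + ((f ∘ suc) ⊛ (g ⊛ h)) n
      ≡⟨ ⊛-at-suc f (g ⊛ h) n ⟨
    (f ⊛ (g ⊛ h)) (suc n) ∎
    where
    open ≡-Reasoning
    regroup : ∀ a b c d e → a * b * c + (a * d + e) ≡ a * (b * c + d) + e
    regroup = solve-∀

  ⊛-commutativeMonoid : CommutativeMonoid _ _
  ⊛-commutativeMonoid = record
    { Carrier = Series
    ; _≈_ = _≈_
    ; _∙_ = _⊛_
    ; ε = one
    ; isCommutativeMonoid = record
      { isMonoid = record
        { isSemigroup = record
          { isMagma = record
            { isEquivalence = record { refl = ≈-refl ; sym = ≈-sym ; trans = ≈-trans }
            ; ∙-cong = ⊛-cong
            }
          ; assoc = ⊛-assoc
          }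
        ; identity = ⊛-identityˡ , ⊛-identityʳ
        }
      ; comm = ⊛-comm
      }
    }

  ≈-setoid : Setoid _ _
  ≈-setoid = CommutativeMonoid.setoid ⊛-commutativeMonoid

  module ≈-Reasoning = SetoidReasoning ≈-setoid

  inv-recurrence : ∀ f n → inv f (suc n) ≡ - ((f ∘ suc) ⊛ inv f) n
  inv-recurrence f n = cong -_ (begin
    foldr _+_ (+ 0) (zipWith _*_ (applyUpTo (f ∘ suc) (suc n)) (invRev f n))
      ≡⟨ cong (λ gs → foldr _+_ (+ 0) (zipWith _*_ (applyUpTo (f ∘ suc) (suc n)) gs)) (invRev-applyUpTo n) ⟩
    foldr _+_ (+ 0) (zipWith _*_ (applyUpTo (f ∘ suc) (suc n)) (applyUpTo (λ i → inv f (n ∸ i)) (suc n)))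
      ≡⟨ cong (foldr _+_ (+ 0)) (zipWith-applyUpTo (f ∘ suc) (λ i → inv f (n ∸ i)) (suc n)) ⟩
    sumUpTo (λ i → f (suc i) * inv f (n ∸ i)) (suc n)
      ≡⟨ ⊛-as-sum (f ∘ suc) (inv f) n ⟨
    ((f ∘ suc) ⊛ inv f) n ∎)
    where
    open ≡-Reasoning
    invRev-applyUpTo : ∀ n → invRev f n ≡ applyUpTo (λ i → inv f (n ∸ i)) (suc n)
    invRev-applyUpTo zero    = refl
    invRev-applyUpTo (suc n) = cong (inv f (suc n) ∷_) (invRev-applyUpTo n)
    zipWith-applyUpTo : ∀ (a b : ℕ → ℤ) k →
      zipWith _*_ (applyUpTo a k) (applyUpTo b k) ≡ applyUpTo (λ i → a i * b i) k
    zipWith-applyUpTo a b zero    = refl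
    zipWith-applyUpTo a b (suc k) = cong (a 0 * b 0 ∷_) (zipWith-applyUpTo (a ∘ suc) (b ∘ suc) k)

  ⊛-inverseʳ : ∀ f → f 0 ≡ + 1 → f ⊛ inv f ≈ one
  ⊛-inverseʳ f f₀≡1 zero    = trans (⊛-at-0 f (inv f)) (cong (_* + 1) f₀≡1)
  ⊛-inverseʳ f f₀≡1 (suc n) = begin
    (f ⊛ inv f) (suc n)         ≡⟨ ⊛-at-suc f (inv f) n ⟩
    f 0 * inv f (suc n) + x     ≡⟨ cong₂ (λ a b → a * b + x) f₀≡1 (inv-recurrence f n) ⟩
    + 1 * - x + x               ≡⟨ cong (_+ x) (ℤP.*-identityˡ (- x)) ⟩
    - x + x                     ≡⟨ ℤP.+-inverseˡ x ⟩
    + 0                         ∎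
    where
    open ≡-Reasoning
    x = ((f ∘ suc) ⊛ inv f) n

  coefficient-of-quotient : ∀ X H Y n → H 0 ≡ + 1 → X ⊛ H ≈[ n ] Y → (Y ⊛ inv H) n ≡ X n
  coefficient-of-quotient X H Y n H₀≡1 X⊛H≈Y = begin
    (Y ⊛ inv H) n         ≡⟨ ⊛-cong[] {g = inv H} n X⊛H≈Y (λ _ _ → refl) n ℕP.≤-refl ⟨
    ((X ⊛ H) ⊛ inv H) n   ≡⟨ ⊛-assoc X H (inv H) n ⟩
    (X ⊛ (H ⊛ inv H)) n   ≡⟨ ⊛-cong {X} ≈-refl (⊛-inverseʳ H H₀≡1) n ⟩
    (X ⊛ one) n           ≡⟨ ⊛-identityʳ X n ⟩
    X n                   ∎
    where open ≡-Reasoning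

module QPochhammer where
  open import Data.Integer using (_+_; _*_)
  open PowerSeries
  open CommutativeSemigroupProperties (CommutativeMonoid.commutativeSemigroup ⊛-commutativeMonoid)
    using (interchange)

  monomial : ℤ → ℕ → Series
  monomial x e j = if ⌊ j ≟ e ⌋ then x else + 0

  ⌊≟⌋-≡ : ∀ {i j} → i ≡ j → ⌊ i ≟ j ⌋ ≡ true
  ⌊≟⌋-≡ {i} {j} i≡j = trans (isYes≗does (i ≟ j)) (dec-true (i ≟ j) i≡j)

  ⌊≟⌋-≢ : ∀ {i j} → i ≢ j → ⌊ i ≟ j ⌋ ≡ false
  ⌊≟⌋-≢ {i} {j} i≢j = trans (isYes≗does (i ≟ j)) (dec-false (i ≟ j) i≢j)

  -- ⌊ i ≟ j ⌋ is stuck on open terms; its underlying does is i ≡ᵇ j, which computes.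
  monomial-shift : ∀ x e → monomial x (suc e) ∘ suc ≈ monomial x e
  monomial-shift x e i =
    cong (λ b → if b then x else + 0) (trans (isYes≗does (suc i ≟ suc e)) (sym (isYes≗does (i ≟ e))))

  monomial-⊛-< : ∀ x e P j → j < e → (monomial x e ⊛ P) j ≡ + 0
  monomial-⊛-< x (suc e) P zero    _         = trans (⊛-at-0 (monomial x (suc e)) P) (ℤP.*-zeroˡ (P 0))
  monomial-⊛-< x (suc e) P (suc j) (s≤s j<e) = begin
    (monomial x (suc e) ⊛ P) (suc j)
      ≡⟨ ⊛-at-suc (monomial x (suc e)) P j ⟩
    + 0 * P (suc j) + ((monomial x (suc e) ∘ suc) ⊛ P) j
      ≡⟨ cong₂ _+_ (ℤP.*-zeroˡ (P (suc j))) (⊛-cong {g = P} (monomial-shift x e) ≈-refl j) ⟩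
    + 0 + (monomial x e ⊛ P) j
      ≡⟨ ℤP.+-identityˡ _ ⟩
    (monomial x e ⊛ P) j
      ≡⟨ monomial-⊛-< x e P j j<e ⟩
    + 0 ∎
    where open ≡-Reasoning

  monomial-⊛-+ : ∀ x e P d → (monomial x e ⊛ P) (e ℕ.+ d) ≡ x * P d
  monomial-⊛-+ x zero    P zero    = ⊛-at-0 (monomial x 0) P
  monomial-⊛-+ x zero    P (suc d) = begin
    (monomial x 0 ⊛ P) (suc d)          ≡⟨ ⊛-at-suc (monomial x 0) P d ⟩
    x * P (suc d) + ((λ _ → + 0) ⊛ P) d ≡⟨ cong (_+_ (x * P (suc d))) (⊛-zeroˡ P d) ⟩
    x * P (suc d) + + 0                 ≡⟨ ℤP.+-identityʳ _ ⟩
    x * P (suc d)                       ∎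
    where open ≡-Reasoning
  monomial-⊛-+ x (suc e) P d = begin
    (monomial x (suc e) ⊛ P) (suc (e ℕ.+ d))
      ≡⟨ ⊛-at-suc (monomial x (suc e)) P (e ℕ.+ d) ⟩
    + 0 * P (suc (e ℕ.+ d)) + ((monomial x (suc e) ∘ suc) ⊛ P) (e ℕ.+ d)
      ≡⟨ cong₂ _+_ (ℤP.*-zeroˡ (P (suc (e ℕ.+ d)))) (⊛-cong {g = P} (monomial-shift x e) ≈-refl (e ℕ.+ d)) ⟩
    + 0 + (monomial x e ⊛ P) (e ℕ.+ d)
      ≡⟨ ℤP.+-identityˡ _ ⟩
    (monomial x e ⊛ P) (e ℕ.+ d)
      ≡⟨ monomial-⊛-+ x e P d ⟩
    x * P d ∎
    where open ≡-Reasoning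

  -- oneMinus c e is pointwise definitionally monomial (+ 1) 0 + monomial (- c) e.
  ⊛-oneMinus-< : ∀ c e P j → j < e → (P ⊛ oneMinus c e) j ≡ P j
  ⊛-oneMinus-< c e P j j<e = begin
    (P ⊛ oneMinus c e) j
      ≡⟨ ⊛-comm P (oneMinus c e) j ⟩
    (oneMinus c e ⊛ P) j
      ≡⟨ ⊛-distribʳ-+ (monomial (+ 1) 0) (monomial (- c) e) P j ⟩
    (monomial (+ 1) 0 ⊛ P) j + (monomial (- c) e ⊛ P) j
      ≡⟨ cong₂ _+_ (monomial-⊛-+ (+ 1) 0 P j) (monomial-⊛-< (- c) e P j j<e) ⟩
    + 1 * P j + + 0
      ≡⟨ trans (ℤP.+-identityʳ _) (ℤP.*-identityˡ (P j)) ⟩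
    P j ∎
    where open ≡-Reasoning

  ⊛-oneMinus-+ : ∀ c e P d → (P ⊛ oneMinus c e) (e ℕ.+ d) ≡ P (e ℕ.+ d) + - c * P d
  ⊛-oneMinus-+ c e P d = begin
    (P ⊛ oneMinus c e) (e ℕ.+ d)
      ≡⟨ ⊛-comm P (oneMinus c e) (e ℕ.+ d) ⟩
    (oneMinus c e ⊛ P) (e ℕ.+ d)
      ≡⟨ ⊛-distribʳ-+ (monomial (+ 1) 0) (monomial (- c) e) P (e ℕ.+ d) ⟩
    (monomial (+ 1) 0 ⊛ P) (e ℕ.+ d) + (monomial (- c) e ⊛ P) (e ℕ.+ d)
      ≡⟨ cong₂ _+_ (monomial-⊛-+ (+ 1) 0 P (e ℕ.+ d)) (monomial-⊛-+ (- c) e P d) ⟩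
    + 1 * P (e ℕ.+ d) + - c * P d
      ≡⟨ cong (_+ - c * P d) (ℤP.*-identityˡ (P (e ℕ.+ d))) ⟩
    P (e ℕ.+ d) + - c * P d ∎
    where open ≡-Reasoning

  oneMinus-at-exponent : ∀ c e → oneMinus c (suc e) (suc e) ≡ - c
  oneMinus-at-exponent c e rewrite ⌊≟⌋-≡ {suc e} refl = ℤP.+-identityˡ (- c)

  oneMinus-at-other : ∀ c e j → suc j ≢ e → oneMinus c e (suc j) ≡ + 0
  oneMinus-at-other c e j j≢e rewrite ⌊≟⌋-≢ j≢e = refl

  ⊛-oneMinus-≈ : ∀ c e P R → (∀ j → j < e → P j ≡ R j) →
    (∀ d → P (e ℕ.+ d) + - c * P d ≡ R (e ℕ.+ d)) → P ⊛ oneMinus c e ≈ R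
  ⊛-oneMinus-≈ c e P R below above j with j ℕP.<? e
  ... | yes j<e = trans (⊛-oneMinus-< c e P j j<e) (below j j<e)
  ... | no  j≮e = subst (λ j → (P ⊛ oneMinus c e) j ≡ R j) (ℕP.m+[n∸m]≡n (ℕP.≮⇒≥ j≮e))
                        (trans (⊛-oneMinus-+ c e P (j ∸ e)) (above (j ∸ e)))

  oneMinus-difference-of-squares : ∀ e →
    oneMinus (- + 1) (suc e) ⊛ oneMinus (+ 1) (suc e) ≈ oneMinus (+ 1) (suc e ℕ.+ suc e)
  oneMinus-difference-of-squares e = ⊛-oneMinus-≈ (+ 1) (suc e) P R below above
    where
    P R : Series
    P = oneMinus (- + 1) (suc e)
    R = oneMinus (+ 1) (suc e ℕ.+ suc e)

    below : ∀ j → j < suc e → P j ≡ R j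
    below zero    _   = refl
    below (suc j) j<e = trans (oneMinus-at-other (- + 1) (suc e) j (ℕP.<⇒≢ j<e))
      (sym (oneMinus-at-other (+ 1) (suc e ℕ.+ suc e) j (ℕP.<⇒≢ (ℕP.<-≤-trans j<e (ℕP.m≤m+n (suc e) (suc e))))))

    above-suc : ∀ d → Dec (suc d ≡ suc e) → P (suc e ℕ.+ suc d) + - + 1 * P (suc d) ≡ R (suc e ℕ.+ suc d)
    above-suc d (yes refl) = trans
      (cong₂ (λ x y → x + - + 1 * y) (oneMinus-at-other (- + 1) (suc e) (e ℕ.+ suc e) (ℕP.m+1+n≢m (suc e)))
                                     (oneMinus-at-exponent (- + 1) e))
      (sym (oneMinus-at-exponent (+ 1) (e ℕ.+ suc e)))
    above-suc d (no d≢e)   = trans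
      (cong₂ (λ x y → x + - + 1 * y) (oneMinus-at-other (- + 1) (suc e) (e ℕ.+ suc d) (ℕP.m+1+n≢m (suc e)))
                                     (oneMinus-at-other (- + 1) (suc e) d d≢e))
      (sym (oneMinus-at-other (+ 1) (suc e ℕ.+ suc e) (e ℕ.+ suc d) (d≢e ∘ ℕP.+-cancelˡ-≡ (suc e) _ _)))

    above : ∀ d → P (suc e ℕ.+ d) + - + 1 * P d ≡ R (suc e ℕ.+ d)
    above zero    rewrite ℕP.+-identityʳ e = trans (cong (_+ - + 1) (oneMinus-at-exponent (- + 1) e))
      (sym (oneMinus-at-other (+ 1) (suc e ℕ.+ suc e) e (λ eq → ℕP.m+1+n≢m (suc e) (sym eq))))
    above (suc d) = above-suc d (suc d ≟ suc e)

  prodUpTo-cong : ∀ {F G} L → (∀ i → F i ≈ G i) → prodUpTo F L ≈ prodUpTo G L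
  prodUpTo-cong zero    F≈G = ≈-refl
  prodUpTo-cong (suc L) F≈G = ⊛-cong (prodUpTo-cong L F≈G) (F≈G L)

  prodUpTo-⊛ : ∀ F G L → prodUpTo F L ⊛ prodUpTo G L ≈ prodUpTo (λ i → F i ⊛ G i) L
  prodUpTo-⊛ F G zero    = ⊛-identityˡ one
  prodUpTo-⊛ F G (suc L) = ≈-trans (interchange (prodUpTo F L) (F L) (prodUpTo G L) (G L))
                                   (⊛-cong (prodUpTo-⊛ F G L) ≈-refl)

  prodUpTo-+ : ∀ F m n → prodUpTo F (m ℕ.+ n) ≈ prodUpTo F m ⊛ prodUpTo (λ i → F (m ℕ.+ i)) n
  prodUpTo-+ F m zero    rewrite ℕP.+-identityʳ m = ≈-sym (⊛-identityʳ (prodUpTo F m))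
  prodUpTo-+ F m (suc n) rewrite ℕP.+-suc m n = begin
    prodUpTo F (m ℕ.+ n) ⊛ F (m ℕ.+ n)              ≈⟨ ⊛-cong (prodUpTo-+ F m n) ≈-refl ⟩
    (prodUpTo F m ⊛ G) ⊛ F (m ℕ.+ n)                ≈⟨ ⊛-assoc (prodUpTo F m) G (F (m ℕ.+ n)) ⟩
    prodUpTo F m ⊛ (G ⊛ F (m ℕ.+ n))                ∎
    where
    open ≈-Reasoning
    G = prodUpTo (λ i → F (m ℕ.+ i)) n

  prodUpTo-one : ∀ F n → (∀ i → i < n → F i ≈ one) → prodUpTo F n ≈ one
  prodUpTo-one F zero    _   = ≈-refl
  prodUpTo-one F (suc n) F≈1 = begin
    prodUpTo F n ⊛ F n ≈⟨ ⊛-cong (prodUpTo-one F n (λ i i<n → F≈1 i (ℕP.m<n⇒m<1+n i<n))) (F≈1 n ℕP.≤-refl) ⟩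
    one ⊛ one          ≈⟨ ⊛-identityˡ one ⟩
    one                ∎
    where open ≈-Reasoning

  pochUpTo : ℤ → ℕ → ℕ → ℕ → Series
  pochUpTo c k m N = prodUpTo (λ i → oneMinus c (k ℕ.+ m ℕ.* i)) N

  pochUpTo-stable : ∀ c k m N j → j < N → pochUpTo c (suc k) (suc m) N j ≡ poch c (suc k) (suc m) j
  pochUpTo-stable c k m (suc N) j (s≤s j≤N) with ℕP.m≤n⇒m<n∨m≡n j≤N
  ... | inj₂ refl = refl
  ... | inj₁ j<N  = trans (⊛-oneMinus-< c _ (pochUpTo c (suc k) (suc m) N) j (ℕP.<-≤-trans j<N N≤exponent))
                          (pochUpTo-stable c k m N j j<N)
    where
    N≤exponent : N ≤ suc k ℕ.+ suc m ℕ.* N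
    N≤exponent = ℕP.≤-trans (ℕP.m≤n*m N (suc m)) (ℕP.m≤n+m _ (suc k))

  poch-≈[] : ∀ c k m n N → n < N → poch c (suc k) (suc m) ≈[ n ] pochUpTo c (suc k) (suc m) N
  poch-≈[] c k m n N n<N j j≤n = sym (pochUpTo-stable c k m N j (ℕP.≤-<-trans j≤n n<N))

  pochUpTo-difference-of-squares : ∀ k m K →
    pochUpTo (- + 1) (suc k) m K ⊛ pochUpTo (+ 1) (suc k) m K ≈ pochUpTo (+ 1) (suc k ℕ.+ suc k) (m ℕ.+ m) K
  pochUpTo-difference-of-squares k m K = ≈-trans (prodUpTo-⊛ _ _ K) (prodUpTo-cong K λ i →
    ≈-trans (oneMinus-difference-of-squares (k ℕ.+ m ℕ.* i))
            (λ j → cong (λ e → oneMinus (+ 1) e j) (exponent (suc k) m i)))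
    where
    exponent : ∀ k m i → (k ℕ.+ m ℕ.* i) ℕ.+ (k ℕ.+ m ℕ.* i) ≡ (k ℕ.+ k) ℕ.+ (m ℕ.+ m) ℕ.* i
    exponent = NatSolver.solve-∀


module Overpartitions where
  open import Data.Nat using (_+_; _*_)

  Bounded : ℕ → List Part → Set
  Bounded m = All (λ x → proj₁ x ≤ m)

  size : List Part → ℕ
  size p = sum (map proj₁ p)

  size-++ : ∀ b r → size (b ++ r) ≡ size b + size r
  size-++ b r = trans (cong sum (List.map-++ proj₁ b r)) (sum-++ (map proj₁ b) (map proj₁ r))

  parts≤size : ∀ p → Bounded (size p) p
  parts≤size []            = []
  parts≤size ((v , _) ∷ p) =
    ℕP.m≤m+n v (size p) ∷ All.map (λ x≤ → ℕP.≤-trans x≤ (ℕP.m≤n+m _ v)) (parts≤size p)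

  Linked-bounded : ∀ {x p} → Linked ConsecOK (x ∷ p) → Bounded (proj₁ x) (x ∷ p)
  Linked-bounded [-] = ℕP.≤-refl ∷ []
  Linked-bounded ((y≤x , _) ∷ linked) =
    ℕP.≤-refl ∷ All.map (λ z≤y → ℕP.≤-trans z≤y y≤x) (Linked-bounded linked)

  Linked-++⁻ʳ : ∀ b {r} → Linked ConsecOK (b ++ r) → Linked ConsecOK r
  Linked-++⁻ʳ []      linked = linked
  Linked-++⁻ʳ (_ ∷ b) linked = Linked-++⁻ʳ b (Linked.tail linked)

  mult-++ : ∀ k xs ys → mult k (xs ++ ys) ≡ mult k xs + mult k ys
  mult-++ k xs ys = trans (cong length (List.filter-++ (λ x → proj₁ x ≟ k) xs ys))
                          (List.length-++ (filter (λ x → proj₁ x ≟ k) xs))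

  mult-absent : ∀ k xs → All (λ x → proj₁ x ≢ k) xs → mult k xs ≡ 0
  mult-absent k xs ≢k = cong length (List.filter-none (λ x → proj₁ x ≟ k) ≢k)

  mult-constant : ∀ k xs → All (λ x → proj₁ x ≡ k) xs → mult k xs ≡ length xs
  mult-constant k xs ≡k = cong length (List.filter-all (λ x → proj₁ x ≟ k) ≡k)

  mult-++-≤ʳ : ∀ k xs ys → mult k ys ≤ mult k (xs ++ ys)
  mult-++-≤ʳ k xs ys = subst (mult k ys ≤_) (sym (mult-++ k xs ys)) (ℕP.m≤n+m (mult k ys) (mult k xs))

  block : ℕ → Bool → ℕ → List Part
  block a o k = (a , o) ∷ replicate k (a , false)

  block-values : ∀ a o k → All (λ x → proj₁ x ≡ a) (block a o k)
  block-values a o k = refl ∷ All.replicate⁺ k refl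

  size-block : ∀ a o k → size (block a o k) ≡ suc k * a
  size-block a o zero    = refl
  size-block a o (suc k) = cong (_+_ a) (size-block a false k)

  length-block : ∀ a o k → length (block a o k) ≡ suc k
  length-block a o k = cong suc (List.length-replicate k)

  Linked-block-++ : ∀ a o k r → Linked ConsecOK r → All (λ x → proj₁ x < a) r →
    Linked ConsecOK (block a o k ++ r)
  Linked-block-++ a o zero    []            _      _         = [-]
  Linked-block-++ a o zero    ((v , _) ∷ r) linked (v<a ∷ _) =
    (ℕP.<⇒≤ v<a , λ a≡v → ⊥-elim (ℕP.<⇒≢ v<a (sym a≡v))) ∷ linked
  Linked-block-++ a o (suc k) r             linked r<a       =
    (ℕP.≤-refl , λ _ → refl) ∷ Linked-block-++ a false k r linked r<a

  ++-cancel-block : ∀ {a} (b b′ : List Part) {r r′ : List Part} →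
    All (λ x → proj₁ x ≡ a) b → All (λ x → proj₁ x ≡ a) b′ →
    All (λ x → proj₁ x < a) r → All (λ x → proj₁ x < a) r′ → b ++ r ≡ b′ ++ r′ → r ≡ r′
  ++-cancel-block []      []       _          _           _         _          eq   = eq
  ++-cancel-block []      (_ ∷ _)  _          (refl ∷ _)  (v<a ∷ _) _          refl = ⊥-elim (ℕP.<-irrefl refl v<a)
  ++-cancel-block (_ ∷ _) []       (refl ∷ _) _           _         (v<a ∷ _)  refl = ⊥-elim (ℕP.<-irrefl refl v<a)
  ++-cancel-block (_ ∷ b) (_ ∷ b′) (_ ∷ b≡a) (_ ∷ b′≡a) r<a       r′<a       eq   =
    ++-cancel-block b b′ b≡a b′≡a r<a r′<a (List.∷-injectiveʳ eq)

  IsRun : ℕ → List Part → Set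
  IsRun a b = b ≡ [] ⊎ ∃₂ λ o k → b ≡ block a o k

  length-run≤mult : ∀ {a b} → IsRun a b → ∀ r → length b ≤ mult a (b ++ r)
  length-run≤mult {a} {b} run r = subst (length b ≤_) (sym (trans (mult-++ a b r) (cong (_+ mult a r)
    (mult-constant a b (values run))))) (ℕP.m≤m+n (length b) (mult a r))
    where
    values : ∀ {b} → IsRun a b → All (λ x → proj₁ x ≡ a) b
    values (inj₁ refl)             = []
    values (inj₂ (o , k , refl)) = block-values a o k

  split-run : ∀ m p → Linked ConsecOK p → Bounded (suc m) p →
    ∃₂ λ b r → p ≡ b ++ r × IsRun (suc m) b × Bounded m r
  split-run m []            _      _            = [] , [] , refl , inj₁ refl , []
  split-run m ((v , o) ∷ p) linked (v≤1+m ∷ p≤) with v ≟ suc m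
  ... | no v≢1+m = [] , (v , o) ∷ p , refl , inj₁ refl ,
    All.map (λ x≤v → ℕP.≤-trans x≤v (ℕP.≤-pred (ℕP.≤∧≢⇒< v≤1+m v≢1+m))) (Linked-bounded linked)
  ... | yes refl with split-run m p (Linked.tail linked) p≤
  ...   | .[] , r , p≡r , inj₁ refl , r≤m =
    block (suc m) o 0 , r , cong ((suc m , o) ∷_) p≡r , inj₂ (o , 0 , refl) , r≤m
  ...   | .(block (suc m) o′ k) , r , p≡b++r , inj₂ (o′ , k , refl) , r≤m =
    block (suc m) o (suc k) , r , cong ((suc m , o) ∷_) (trans p≡b++r (cong (λ o → (suc m , o) ∷ _) o′≡false)) ,
    inj₂ (o , suc k , refl) , r≤m
    where
    o′≡false : o′ ≡ false
    o′≡false = proj₂ (Linked.head (subst (λ q → Linked ConsecOK ((suc m , o) ∷ q)) p≡b++r linked)) refl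


module DuplicateOverpartitions (t : ℕ) where
  open import Data.Nat using (_+_; _*_)
  open PowerSeries
  open QPochhammer
  open Overpartitions

  IsDupOverpartition : ℕ → List Part → Set
  IsDupOverpartition n p = IsOverpartition n p × (∀ k → 1 < mult k p → t ∣ k)

  -- block a o k, made of k + 1 parts a, has size j and may occur in a t-duplicate overpartition
  Admissible : ℕ → ℕ → ℕ → Set
  Admissible a j k = suc k * a ≡ j × (k ≡ 0 ⊎ t ∣ a)

  admissible-unique : ∀ a .{{_ : NonZero a}} {j k k′} → Admissible a j k → Admissible a j k′ → k ≡ k′
  admissible-unique a (e , _) (e′ , _) = ℕP.suc-injective (ℕP.*-cancelʳ-≡ _ _ a (trans e (sym e′)))

  admissible? : ∀ a .{{_ : NonZero a}} j → Dec (∃ (Admissible a j))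
  admissible? a j with (suc k * a ≟ j) ×-dec ((k ≟ 0) ⊎-dec (t ∣? a))
    where k = j / a ∸ 1
  ... | yes adm = yes (_ , adm)
  ... | no ¬adm = no λ { (k , adm) → ¬adm (subst (Admissible a j) (quotient k adm) adm) }
    where
    quotient : ∀ k → Admissible a j k → k ≡ j / a ∸ 1
    quotient k (e , _) = sym (trans (cong (λ x → x / a ∸ 1) (sym e)) (cong (_∸ 1) (m*n/n≡m (suc k) a)))

  blocksOf : ∀ {a j} → Dec (∃ (Admissible a j)) → List (List Part)
  blocksOf {a} (yes (k , _)) = block a true k ∷ block a false k ∷ []
  blocksOf     (no _)        = []

  -- the candidates for the list of all parts equal to a, when these sum to j
  blocks : ∀ a .{{_ : NonZero a}} → ℕ → List (List Part)
  blocks a zero    = [] ∷ []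
  blocks a (suc j) = blocksOf (admissible? a (suc j))

  blockSeries : ∀ a .{{_ : NonZero a}} → Series
  blockSeries a j = + length (blocks a j)

  ∈-blocks⁻ : ∀ a .{{_ : NonZero a}} j {b} → b ∈ blocks a j →
    (b ≡ [] × j ≡ 0) ⊎ ∃₂ λ o k → b ≡ block a o k × Admissible a j k
  ∈-blocks⁻ a zero    (here refl) = inj₁ (refl , refl)
  ∈-blocks⁻ a (suc j) b∈ with admissible? a (suc j)
  ∈-blocks⁻ a (suc j) (here refl)         | yes (k , adm) = inj₂ (true , k , refl , adm)
  ∈-blocks⁻ a (suc j) (there (here refl)) | yes (k , adm) = inj₂ (false , k , refl , adm)

  ∈-blocks⁺ : ∀ a .{{_ : NonZero a}} {j k} o → Admissible a j k → block a o k ∈ blocks a j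
  ∈-blocks⁺ a {zero}  {k} o (size≡0 , _) = ⊥-elim (ℕ.≢-nonZero⁻¹ (suc k * a) {{ℕP.m*n≢0 (suc k) a}} size≡0)
  ∈-blocks⁺ a {suc j} o adm with admissible? a (suc j)
  ... | no ¬adm = ⊥-elim (¬adm (_ , adm))
  ... | yes (k′ , adm′) with admissible-unique a adm adm′
  ∈-blocks⁺ a {suc j} true  adm | yes _ | refl = here refl
  ∈-blocks⁺ a {suc j} false adm | yes _ | refl = there (here refl)

  blocks-values : ∀ a .{{_ : NonZero a}} j {b} → b ∈ blocks a j → All (λ x → proj₁ x ≡ a) b
  blocks-values a j b∈ with ∈-blocks⁻ a j b∈
  ... | inj₁ (refl , _)         = []
  ... | inj₂ (o , k , refl , _) = block-values a o k

  cartesianProductWith-++-unique : ∀ a .{{_ : NonZero a}} j {R} → Unique R →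
    Unique (cartesianProductWith _++_ (blocks a j) R)
  cartesianProductWith-++-unique a zero    unique = Unique.++⁺ (Unique.map⁺ id unique) [] (λ ())
  cartesianProductWith-++-unique a (suc j) {R} unique with admissible? a (suc j)
  ... | no _        = []
  ... | yes (k , _) = Unique.++⁺ (prefixed true) (Unique.++⁺ (prefixed false) [] λ ()) disjoint
    where
    prefixed : ∀ o → Unique (map (block a o k ++_) R)
    prefixed o = Unique.map⁺ (List.++-cancelˡ (block a o k) _ _) unique
    disjoint : Disjoint (map (block a true k ++_) R) (map (block a false k ++_) R ++ [])
    disjoint (v∈₁ , v∈₂) with ∈-map⁻ _ v∈₁ | ∈-++⁻ (map (block a false k ++_) R) v∈₂
    ... | _ , _ , refl | inj₁ v∈₂′ with ∈-map⁻ _ v∈₂′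
    ...   | _ , _ , ()

  -- An overpartition with parts at most suc m is a run of parts suc m
  -- followed by an overpartition of some i ≤ n with parts at most m.
  enumeration : ℕ → ℕ → List (List Part)
  extensions  : ℕ → ℕ → ℕ → List (List Part)

  enumeration zero    zero    = [] ∷ []
  enumeration zero    (suc n) = []
  enumeration (suc m) n       = concat (applyUpTo (extensions m n) (suc n))

  extensions m n i = cartesianProductWith _++_ (blocks (suc m) (n ∸ i)) (enumeration m i)

  countSeries : ℕ → Series
  countSeries m n = + length (enumeration m n)

  ∈-enumeration-suc⁻ : ∀ m n {p} → p ∈ enumeration (suc m) n →
    ∃ λ i → i ≤ n × ∃₂ λ b r → b ∈ blocks (suc m) (n ∸ i) × r ∈ enumeration m i × p ≡ b ++ r
  ∈-enumeration-suc⁻ m n p∈ with ∈-concat⁻′ (applyUpTo (extensions m n) (suc n)) p∈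
  ... | _ , p∈ext , ext∈ with ∈-applyUpTo⁻ (extensions m n) ext∈
  ... | i , i<1+n , refl =
    i , ℕP.≤-pred i<1+n , ∈-cartesianProductWith⁻ _++_ (blocks (suc m) (n ∸ i)) (enumeration m i) p∈ext

  ∈-enumeration-suc⁺ : ∀ m n i {b r} → i ≤ n → b ∈ blocks (suc m) (n ∸ i) → r ∈ enumeration m i →
    b ++ r ∈ enumeration (suc m) n
  ∈-enumeration-suc⁺ m n i i≤n b∈ r∈ =
    ∈-concat⁺′ (∈-cartesianProductWith⁺ _++_ b∈ r∈) (∈-applyUpTo⁺ (extensions m n) (s≤s i≤n))

  block-++-duplicates : ∀ {a j k} o r → Admissible a j k → All (λ x → proj₁ x < a) r →
    (∀ k′ → 1 < mult k′ r → t ∣ k′) → ∀ k′ → 1 < mult k′ (block a o k ++ r) → t ∣ k′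
  block-++-duplicates {a} {j} {k} o r (_ , repeatable) r<a dup k′ 1<mult with k′ ≟ a
  ... | yes refl = repeated repeatable (subst (1 <_) mult≡ 1<mult)
    where
    mult≡ : mult a (block a o k ++ r) ≡ suc k
    mult≡ = trans (mult-++ a (block a o k) r) (trans
                  (cong₂ _+_ (trans (mult-constant a (block a o k) (block-values a o k)) (length-block a o k))
                             (mult-absent a r (All.map ℕP.<⇒≢ r<a)))
                  (ℕP.+-identityʳ (suc k)))
    repeated : k ≡ 0 ⊎ t ∣ a → 1 < suc k → t ∣ a
    repeated (inj₁ refl) (s≤s ())
    repeated (inj₂ t∣a)  _ = t∣a
  ... | no k′≢a = dup k′ (subst (1 <_) mult≡ 1<mult)
    where
    mult≡ : mult k′ (block a o k ++ r) ≡ mult k′ r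
    mult≡ = trans (mult-++ k′ (block a o k) r) (cong (_+ mult k′ r)
      (mult-absent k′ (block a o k) (All.map (λ v≡a v≡k′ → k′≢a (trans (sym v≡k′) v≡a)) (block-values a o k))))

  enumeration-sound : ∀ m n {p} → p ∈ enumeration m n → IsDupOverpartition n p × Bounded m p
  enumeration-sound zero    zero (here refl) = (([] , [] , refl) , λ _ ()) , []
  enumeration-sound (suc m) n  p∈ with ∈-enumeration-suc⁻ m n p∈
  ... | i , i≤n , b , r , b∈ , r∈ , refl with enumeration-sound m i r∈ | ∈-blocks⁻ (suc m) (n ∸ i) b∈
  ... | ((pos , linked , size≡i) , dup) , r≤m | inj₁ (refl , n∸i≡0) =
    ((pos , linked , trans size≡i (ℕP.≤-antisym i≤n (ℕP.m∸n≡0⇒m≤n n∸i≡0))) , dup) , All.map ℕP.m≤n⇒m≤1+n r≤m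
  ... | ((pos , linked , size≡i) , dup) , r≤m | inj₂ (o , k , refl , adm@(size≡n∸i , _)) =
    ((pos′ , Linked-block-++ (suc m) o k r linked r<a , size≡n) , block-++-duplicates o r adm r<a dup) , bounded
    where
    r<a = All.map s≤s r≤m
    pos′ = All.++⁺ (All.map (λ v≡a → subst (1 ≤_) (sym v≡a) (s≤s z≤n)) (block-values (suc m) o k)) pos
    size≡n = trans (size-++ (block (suc m) o k) r)
                   (trans (cong₂ _+_ (trans (size-block (suc m) o k) size≡n∸i) size≡i) (ℕP.m∸n+n≡m i≤n))
    bounded = All.++⁺ (All.map ℕP.≤-reflexive (block-values (suc m) o k)) (All.map ℕP.m≤n⇒m≤1+n r≤m)

  run∈blocks : ∀ a .{{_ : NonZero a}} {b} → IsRun a b → (1 < length b → t ∣ a) → b ∈ blocks a (size b)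
  run∈blocks a (inj₁ refl)             _   = here refl
  run∈blocks a (inj₂ (o , k , refl)) dup = ∈-blocks⁺ a o (sym (size-block a o k) , repeatable k dup)
    where
    repeatable : ∀ k → (1 < length (block a o k) → t ∣ a) → k ≡ 0 ⊎ t ∣ a
    repeatable zero    _   = inj₁ refl
    repeatable (suc k) dup = inj₂ (dup (s≤s (s≤s z≤n)))

  enumeration-complete : ∀ m n p → IsDupOverpartition n p → Bounded m p → p ∈ enumeration m n
  enumeration-complete zero n [] ((_ , _ , size≡n) , _) _ = subst (λ n → [] ∈ enumeration 0 n) size≡n (here refl)
  enumeration-complete zero n (_ ∷ _) ((1≤v ∷ _ , _) , _) (v≤0 ∷ _) with () ← ℕP.≤-trans 1≤v v≤0
  enumeration-complete (suc m) n p ((pos , linked , size≡n) , dup) p≤1+m with split-run m p linked p≤1+m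
  ... | b , r , refl , run , r≤m =
    ∈-enumeration-suc⁺ m n (size r) size-r≤n (subst (λ j → b ∈ blocks (suc m) j) size-b≡n∸size-r b∈) r∈
    where
    sizes : size b + size r ≡ n
    sizes = trans (sym (size-++ b r)) size≡n
    size-r≤n : size r ≤ n
    size-r≤n = subst (size r ≤_) sizes (ℕP.m≤n+m (size r) (size b))
    size-b≡n∸size-r : size b ≡ n ∸ size r
    size-b≡n∸size-r = sym (trans (cong (_∸ size r) (sym sizes)) (ℕP.m+n∸n≡m (size b) (size r)))
    r∈ : r ∈ enumeration m (size r)
    r∈ = enumeration-complete m (size r) r
      ((All.++⁻ʳ b pos , Linked-++⁻ʳ b linked , refl) , λ k 1<mult → dup k (ℕP.<-≤-trans 1<mult (mult-++-≤ʳ k b r)))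
      r≤m
    b∈ : b ∈ blocks (suc m) (size b)
    b∈ = run∈blocks (suc m) run λ 1<length → dup (suc m) (ℕP.<-≤-trans 1<length (length-run≤mult run r))

  extensions-disjoint : ∀ m n {i j} → i ≢ j → Disjoint (extensions m n i) (extensions m n j)
  extensions-disjoint m n {i} {j} i≢j (p∈i , p∈j)
    with ∈-cartesianProductWith⁻ _++_ (blocks (suc m) (n ∸ i)) (enumeration m i) p∈i
       | ∈-cartesianProductWith⁻ _++_ (blocks (suc m) (n ∸ j)) (enumeration m j) p∈j
  ... | b , r , b∈ , r∈ , refl | b′ , r′ , b′∈ , r′∈ , b++r≡b′++r′ =
    i≢j (trans (sym (size≡ r∈)) (trans (cong size r≡r′) (size≡ r′∈)))
    where
    size≡ : ∀ {i r} → r ∈ enumeration m i → size r ≡ i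
    size≡ r∈ = proj₂ (proj₂ (proj₁ (proj₁ (enumeration-sound m _ r∈))))
    below : ∀ {i r} → r ∈ enumeration m i → All (λ x → proj₁ x < suc m) r
    below r∈ = All.map s≤s (proj₂ (enumeration-sound m _ r∈))
    r≡r′ : r ≡ r′
    r≡r′ = ++-cancel-block b b′ (blocks-values (suc m) (n ∸ i) b∈) (blocks-values (suc m) (n ∸ j) b′∈)
                           (below r∈) (below r′∈) b++r≡b′++r′

  enumeration-unique : ∀ m n → Unique (enumeration m n)
  enumeration-unique zero    zero    = [] ∷ []
  enumeration-unique zero    (suc n) = []
  enumeration-unique (suc m) n       = Unique.concat⁺
    (All.applyUpTo⁺₂ (extensions m n) (suc n) λ i →
      cartesianProductWith-++-unique (suc m) (n ∸ i) (enumeration-unique m i))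
    (AllPairs.applyUpTo⁺₁ (extensions m n) (suc n) λ i<j _ → extensions-disjoint m n (ℕP.<⇒≢ i<j))

  enumeration-HasCount : ∀ m n → n ≤ m → HasCount (IsDupOverpartition n) (countSeries m n)
  enumeration-HasCount m n n≤m =
    enumeration m n , enumeration-unique m n , (λ p → mk⇔ (proj₁ ∘ enumeration-sound m n) (complete p)) , refl
    where
    complete : ∀ p → IsDupOverpartition n p → p ∈ enumeration m n
    complete p dop@((_ , _ , size≡n) , _) = enumeration-complete m n p dop
      (All.map (λ v≤ → ℕP.≤-trans v≤ (subst (_≤ m) (sym size≡n) n≤m)) (parts≤size p))

  countSeries-suc : ∀ m → countSeries (suc m) ≈ countSeries m ⊛ blockSeries (suc m)
  countSeries-suc m n = begin
    + length (concat (applyUpTo (extensions m n) (suc n)))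
      ≡⟨ length-concat-applyUpTo (extensions m n) (suc n) ⟩
    sumUpTo (λ i → + length (extensions m n i)) (suc n)
      ≡⟨ sumUpTo-cong (suc n) (λ i _ → length-extensions i) ⟩
    sumUpTo (λ i → countSeries m i ℤ.* blockSeries (suc m) (n ∸ i)) (suc n)
      ≡⟨ ⊛-as-sum (countSeries m) (blockSeries (suc m)) n ⟨
    (countSeries m ⊛ blockSeries (suc m)) n ∎
    where
    open ≡-Reasoning
    length-extensions : ∀ i → + length (extensions m n i) ≡ countSeries m i ℤ.* blockSeries (suc m) (n ∸ i)
    length-extensions i = trans
      (cong +_ (trans (length-cartesianProductWith _++_ (blocks (suc m) (n ∸ i)) (enumeration m i))
                      (ℕP.*-comm (length (blocks (suc m) (n ∸ i))) _)))
      (ℤP.pos-* (length (enumeration m i)) _)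

  countSeries-prodUpTo : ∀ m → countSeries m ≈ prodUpTo (λ a → blockSeries (suc a)) m
  countSeries-prodUpTo zero    zero    = refl
  countSeries-prodUpTo zero    (suc n) = refl
  countSeries-prodUpTo (suc m) =
    ≈-trans (countSeries-suc m) (⊛-cong {g = blockSeries (suc m)} (countSeries-prodUpTo m) ≈-refl)

  blockSeries-admissible : ∀ a .{{_ : NonZero a}} j {k} → Admissible a (suc j) k → blockSeries a (suc j) ≡ + 2
  blockSeries-admissible a j adm with admissible? a (suc j)
  ... | yes _   = refl
  ... | no ¬adm = ⊥-elim (¬adm (_ , adm))

  blockSeries-inadmissible : ∀ a .{{_ : NonZero a}} j → (∀ k → ¬ Admissible a (suc j) k) →
    blockSeries a (suc j) ≡ + 0
  blockSeries-inadmissible a j ¬adm with admissible? a (suc j)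
  ... | yes (k , adm) = ⊥-elim (¬adm k adm)
  ... | no _          = refl

  blockSeries-∤ : ∀ a → ¬ t ∣ suc a → blockSeries (suc a) ≈ oneMinus (- + 2) (suc a)
  blockSeries-∤ a t∤a zero    = refl
  blockSeries-∤ a t∤a (suc j) = at j (suc j ≟ suc a)
    where
    at : ∀ j → Dec (suc j ≡ suc a) → blockSeries (suc a) (suc j) ≡ oneMinus (- + 2) (suc a) (suc j)
    at j (yes refl) = trans (blockSeries-admissible (suc a) a (ℕP.*-identityˡ (suc a) , inj₁ refl))
                            (sym (oneMinus-at-exponent (- + 2) a))
    at j (no j≢a)   = trans (blockSeries-inadmissible (suc a) j inadmissible)
                            (sym (oneMinus-at-other (- + 2) (suc a) j j≢a))
      where
      inadmissible : ∀ k → ¬ Admissible (suc a) (suc j) k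
      inadmissible zero    (size≡ , _)      = j≢a (trans (sym size≡) (ℕP.*-identityˡ (suc a)))
      inadmissible (suc k) (_ , inj₁ ())
      inadmissible (suc k) (_ , inj₂ t∣a) = t∤a t∣a

  blockSeries-periodic : ∀ a d → t ∣ suc a → blockSeries (suc a) (suc a + suc d) ≡ blockSeries (suc a) (suc d)
  blockSeries-periodic a d t∣a with admissible? (suc a) (suc d)
  ... | yes (k , size≡ , _) =
    blockSeries-admissible (suc a) (a + suc d) {suc k} (cong (_+_ (suc a)) size≡ , inj₂ t∣a)
  ... | no ¬adm             = blockSeries-inadmissible (suc a) (a + suc d) inadmissible
    where
    inadmissible : ∀ k → ¬ Admissible (suc a) (suc a + suc d) k
    inadmissible zero    (size≡ , _) = ℕP.m+1+n≢m (suc a) (trans (sym size≡) (ℕP.*-identityˡ (suc a)))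
    inadmissible (suc k) (size≡ , _) = ¬adm (k , ℕP.+-cancelˡ-≡ (suc a) _ _ size≡ , inj₂ t∣a)

  blockSeries-∣ : ∀ a → t ∣ suc a → blockSeries (suc a) ⊛ oneMinus (+ 1) (suc a) ≈ oneMinus (- + 1) (suc a)
  blockSeries-∣ a t∣a = ⊛-oneMinus-≈ (+ 1) (suc a) B (oneMinus (- + 1) (suc a)) below above
    where
    B : Series
    B = blockSeries (suc a)

    below : ∀ j → j < suc a → B j ≡ oneMinus (- + 1) (suc a) j
    below zero    _   = refl
    below (suc j) j<a = trans
      (blockSeries-inadmissible (suc a) j λ k (size≡ , _) →
        ℕP.<⇒≱ j<a (subst (suc a ≤_) size≡ (ℕP.m≤m+n (suc a) (k * suc a))))
      (sym (oneMinus-at-other (- + 1) (suc a) j (ℕP.<⇒≢ j<a)))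

    above : ∀ d → B (suc a + d) ℤ.+ - + 1 ℤ.* B d ≡ oneMinus (- + 1) (suc a) (suc a + d)
    above zero    rewrite ℕP.+-identityʳ a =
      trans (cong (ℤ._+ - + 1) (blockSeries-admissible (suc a) a (ℕP.*-identityˡ (suc a) , inj₁ refl)))
            (sym (oneMinus-at-exponent (- + 1) a))
    above (suc d) = begin
      B (suc a + suc d) ℤ.+ - + 1 ℤ.* B (suc d) ≡⟨ cong₂ ℤ._+_ (blockSeries-periodic a d t∣a) (ℤP.-1*i≡-i (B (suc d))) ⟩
      B (suc d) ℤ.+ - B (suc d)                 ≡⟨ ℤP.+-inverseʳ (B (suc d)) ⟩
      + 0                                       ≡⟨ oneMinus-at-other (- + 1) (suc a) (a + suc d) (ℕP.m+1+n≢m (suc a)) ⟨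
      oneMinus (- + 1) (suc a) (suc a + suc d)  ∎
      where open ≡-Reasoning


productFormula : ℕ → Series
productFormula t = poch (- + 2) 1 1 ⊛ poch (- + 1) t t ⊛ inv (poch (- + 2) t t ⊛ poch (+ 1) t t)

productFormula′ : ℕ → ℕ → Series
productFormula′ t s =
  poch (- + 2) 1 1 ⊛ poch (+ 1) s s ⊛ inv (poch (- + 2) t t ⊛ (poch (+ 1) t t ⊛ poch (+ 1) t t))

GeneratingFunction : ℕ → ℕ → ℕ → Set
GeneratingFunction t s n =
  HasCount (DuplicateOverpartitions.IsDupOverpartition t n) (productFormula t n)
  × productFormula t n ≡ productFormula′ t s n


module ProductFormula (t′ : ℕ) where
  open import Data.Nat using (_+_; _*_)
  open PowerSeries
  open QPochhammer
  open DuplicateOverpartitions (suc t′)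
  open CommutativeSemigroupProperties (CommutativeMonoid.commutativeSemigroup ⊛-commutativeMonoid)
    using (x∙yz≈y∙xz)

  t : ℕ
  t = suc t′

  onMultiples : (ℕ → Series) → ℕ → Series
  onMultiples G e with t ∣? e
  ... | yes _ = G e
  ... | no  _ = one

  onMultiples-∣ : ∀ G {e} → t ∣ e → onMultiples G e ≈ G e
  onMultiples-∣ G {e} t∣e with t ∣? e
  ... | yes _  = ≈-refl
  ... | no t∤e = ⊥-elim (t∤e t∣e)

  onMultiples-∤ : ∀ G {e} → ¬ t ∣ e → onMultiples G e ≈ one
  onMultiples-∤ G {e} t∤e with t ∣? e
  ... | yes t∣e = ⊥-elim (t∤e t∣e)
  ... | no _    = ≈-refl

  ∤-between-multiples : ∀ K r → r < t′ → ¬ t ∣ suc (K * t + r)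
  ∤-between-multiples K r r<t′ t∣ =
    ℕP.<⇒≱ (s≤s r<t′) (∣⇒≤ (∣m+n∣m⇒∣n (subst (t ∣_) (sym (ℕP.+-suc (K * t) r)) t∣) (n∣m*n K)))

  prodUpTo-onMultiples : ∀ G K → prodUpTo (λ a → onMultiples G (suc a)) (K * t) ≈ prodUpTo (λ i → G (t + t * i)) K
  prodUpTo-onMultiples G zero    = ≈-refl
  prodUpTo-onMultiples G (suc K) = begin
    prodUpTo R (t + K * t)                                 ≡⟨ cong (prodUpTo R) (ℕP.+-comm t (K * t)) ⟩
    prodUpTo R (K * t + t)                                 ≈⟨ prodUpTo-+ R (K * t) t ⟩
    prodUpTo R (K * t) ⊛ prodUpTo (λ r → R (K * t + r)) t  ≈⟨ ⊛-cong (prodUpTo-onMultiples G K) lastBlock ⟩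
    prodUpTo (λ i → G (t + t * i)) K ⊛ G (t + t * K)       ∎
    where
    open ≈-Reasoning
    R : ℕ → Series
    R a = onMultiples G (suc a)
    multiple : suc (K * t + t′) ≡ t + K * t
    multiple = trans (sym (ℕP.+-suc (K * t) t′)) (ℕP.+-comm (K * t) t)
    lastBlock : prodUpTo (λ r → R (K * t + r)) t ≈ G (t + t * K)
    lastBlock = begin
      prodUpTo (λ r → R (K * t + r)) t′ ⊛ R (K * t + t′)
        ≈⟨ ⊛-cong (prodUpTo-one (λ r → R (K * t + r)) t′ λ r r<t′ → onMultiples-∤ G (∤-between-multiples K r r<t′))
                  (onMultiples-∣ G (divides (suc K) multiple)) ⟩
      one ⊛ G (suc (K * t + t′))
        ≈⟨ ⊛-identityˡ (G (suc (K * t + t′))) ⟩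
      G (suc (K * t + t′))
        ≡⟨ cong G (trans multiple (cong (_+_ t) (ℕP.*-comm K t))) ⟩
      G (t + t * K) ∎

  denominatorFactor : ℕ → Series
  denominatorFactor e = oneMinus (- + 2) e ⊛ oneMinus (+ 1) e

  blockSeries-factor : ∀ a →
    blockSeries (suc a) ⊛ onMultiples denominatorFactor (suc a)
      ≈ oneMinus (- + 2) (suc a) ⊛ onMultiples (oneMinus (- + 1)) (suc a)
  blockSeries-factor a with t ∣? suc a
  ... | yes t∣a = begin
    blockSeries (suc a) ⊛ (oneMinus (- + 2) (suc a) ⊛ oneMinus (+ 1) (suc a))
      ≈⟨ x∙yz≈y∙xz (blockSeries (suc a)) (oneMinus (- + 2) (suc a)) (oneMinus (+ 1) (suc a)) ⟩
    oneMinus (- + 2) (suc a) ⊛ (blockSeries (suc a) ⊛ oneMinus (+ 1) (suc a))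
      ≈⟨ ⊛-cong {oneMinus (- + 2) (suc a)} ≈-refl (blockSeries-∣ a t∣a) ⟩
    oneMinus (- + 2) (suc a) ⊛ oneMinus (- + 1) (suc a) ∎
    where open ≈-Reasoning
  ... | no t∤a = ⊛-cong {g = one} (blockSeries-∤ a t∤a) ≈-refl

  product-identity : ∀ K →
    prodUpTo (λ a → blockSeries (suc a)) (K * t) ⊛ (pochUpTo (- + 2) t t K ⊛ pochUpTo (+ 1) t t K)
      ≈ pochUpTo (- + 2) 1 1 (K * t) ⊛ pochUpTo (- + 1) t t K
  product-identity K = begin
    Q ⊛ (pochUpTo (- + 2) t t K ⊛ pochUpTo (+ 1) t t K)
      ≈⟨ ⊛-cong {Q} ≈-refl (prodUpTo-⊛ _ _ K) ⟩
    Q ⊛ prodUpTo (λ i → denominatorFactor (t + t * i)) K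
      ≈⟨ ⊛-cong {Q} ≈-refl (prodUpTo-onMultiples denominatorFactor K) ⟨
    Q ⊛ prodUpTo (λ a → onMultiples denominatorFactor (suc a)) (K * t)
      ≈⟨ prodUpTo-⊛ _ _ (K * t) ⟩
    prodUpTo (λ a → blockSeries (suc a) ⊛ onMultiples denominatorFactor (suc a)) (K * t)
      ≈⟨ prodUpTo-cong (K * t) blockSeries-factor ⟩
    prodUpTo (λ a → oneMinus (- + 2) (suc a) ⊛ onMultiples (oneMinus (- + 1)) (suc a)) (K * t)
      ≈⟨ prodUpTo-⊛ _ _ (K * t) ⟨
    prodUpTo (λ a → oneMinus (- + 2) (suc a)) (K * t)
      ⊛ prodUpTo (λ a → onMultiples (oneMinus (- + 1)) (suc a)) (K * t)
      ≈⟨ ⊛-cong (prodUpTo-cong (K * t) λ a j → cong (λ e → oneMinus (- + 2) (suc e) j) (sym (ℕP.+-identityʳ a)))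
                (prodUpTo-onMultiples (oneMinus (- + 1)) K) ⟩
    pochUpTo (- + 2) 1 1 (K * t) ⊛ pochUpTo (- + 1) t t K ∎
    where
    open ≈-Reasoning
    Q = prodUpTo (λ a → blockSeries (suc a)) (K * t)

  module _ (n : ℕ) where
    private
      K L : ℕ
      K = suc n
      L = K * t

      n<L : n < L
      n<L = ℕP.m≤m*n K t

      Q A B C D : Series
      Q = prodUpTo (λ a → blockSeries (suc a)) L
      A = pochUpTo (- + 2) 1 1 L
      B = pochUpTo (- + 1) t t K
      C = pochUpTo (- + 2) t t K
      D = pochUpTo (+ 1) t t K

    -- the constant terms of the denominators compute to + 1, hence the refl
    productFormula-coefficient : productFormula t n ≡ Q n
    productFormula-coefficient = coefficient-of-quotient Q _ _ n refl λ j j≤n → begin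
      (Q ⊛ (poch (- + 2) t t ⊛ poch (+ 1) t t)) j
        ≡⟨ ⊛-cong[] {Q} n (λ _ _ → refl) (⊛-cong[] n (poch-≈[] (- + 2) t′ t′ n K ℕP.≤-refl)
                                                    (poch-≈[] (+ 1) t′ t′ n K ℕP.≤-refl)) j j≤n ⟩
      (Q ⊛ (C ⊛ D)) j
        ≡⟨ product-identity K j ⟩
      (A ⊛ B) j
        ≡⟨ ⊛-cong[] n (poch-≈[] (- + 2) 0 0 n L n<L) (poch-≈[] (- + 1) t′ t′ n K ℕP.≤-refl) j j≤n ⟨
      (poch (- + 2) 1 1 ⊛ poch (- + 1) t t) j ∎
      where open ≡-Reasoning

    productFormula′-coefficient : productFormula′ t (t + t) n ≡ Q n
    productFormula′-coefficient = coefficient-of-quotient Q _ _ n refl λ j j≤n → begin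
      (Q ⊛ (poch (- + 2) t t ⊛ (poch (+ 1) t t ⊛ poch (+ 1) t t))) j
        ≡⟨ ⊛-cong[] {Q} n (λ _ _ → refl) (⊛-cong[] n (poch-≈[] (- + 2) t′ t′ n K ℕP.≤-refl)
             (⊛-cong[] n (poch-≈[] (+ 1) t′ t′ n K ℕP.≤-refl) (poch-≈[] (+ 1) t′ t′ n K ℕP.≤-refl))) j j≤n ⟩
      (Q ⊛ (C ⊛ (D ⊛ D))) j
        ≡⟨ ⊛-cong {Q} ≈-refl (≈-sym (⊛-assoc C D D)) j ⟩
      (Q ⊛ ((C ⊛ D) ⊛ D)) j
        ≡⟨ ⊛-assoc Q (C ⊛ D) D j ⟨
      ((Q ⊛ (C ⊛ D)) ⊛ D) j
        ≡⟨ ⊛-cong {g = D} (product-identity K) ≈-refl j ⟩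
      ((A ⊛ B) ⊛ D) j
        ≡⟨ ⊛-assoc A B D j ⟩
      (A ⊛ (B ⊛ D)) j
        ≡⟨ ⊛-cong {A} ≈-refl (pochUpTo-difference-of-squares t′ t K) j ⟩
      (A ⊛ pochUpTo (+ 1) (t + t) (t + t) K) j
        ≡⟨ ⊛-cong[] n (poch-≈[] (- + 2) 0 0 n L n<L) (poch-≈[] (+ 1) (t′ + t) (t′ + t) n K ℕP.≤-refl) j j≤n ⟨
      (poch (- + 2) 1 1 ⊛ poch (+ 1) (t + t) (t + t)) j ∎
      where open ≡-Reasoning

    generatingFunction : GeneratingFunction t (t + t) n
    generatingFunction =
      subst (HasCount (IsDupOverpartition n)) (trans (countSeries-prodUpTo L n) (sym productFormula-coefficient))
            (enumeration-HasCount L n (ℕP.<⇒≤ n<L)) ,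
      trans productFormula-coefficient (sym productFormula′-coefficient)


half-of-even : ∀ {s} → 2 ∣ s → 4 ≤ s → ∃ λ t′ → s / 2 ≡ suc t′ × s ≡ suc t′ ℕ.+ suc t′
half-of-even (divides zero     refl) ()
half-of-even (divides (suc t′) refl) _ = t′ , m*n/n≡m (suc t′) 2 , double (suc t′)
  where
  double : ∀ x → x ℕ.* 2 ≡ x ℕ.+ x
  double = NatSolver.solve-∀

theorem18 : (s : ℕ) → 2 ∣ s → 4 ≤ s → (n : ℕ) →
    HasCount (IsSDupOverpartition s n)
      ((poch (- + 2) 1 1 ⊛ poch (- + 1) (s / 2) (s / 2)
          ⊛ inv (poch (- + 2) (s / 2) (s / 2) ⊛ poch (+ 1) (s / 2) (s / 2))) n)
    × ((poch (- + 2) 1 1 ⊛ poch (- + 1) (s / 2) (s / 2)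
          ⊛ inv (poch (- + 2) (s / 2) (s / 2) ⊛ poch (+ 1) (s / 2) (s / 2))) n
       ≡ (poch (- + 2) 1 1 ⊛ poch (+ 1) s s
          ⊛ inv (poch (- + 2) (s / 2) (s / 2)
                 ⊛ (poch (+ 1) (s / 2) (s / 2) ⊛ poch (+ 1) (s / 2) (s / 2)))) n)
theorem18 s 2∣s 4≤s n with half-of-even 2∣s 4≤s
... | t′ , s/2≡t , s≡t+t =
  subst₂ (λ t s → GeneratingFunction t s n) (sym s/2≡t) (sym s≡t+t) (ProductFormula.generatingFunction t′ n)
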